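{- Let $\mathcal{M}$ be a simple matroid on $[n]$ with set of circuits $\mathfrak{C}(\mathcal{M})$, and let $\mathbb{K}$ be a field. For every subset $\mathfrak{C}'\subseteq\mathfrak{C}(\mathcal{M})$ we have $c\ell_\Delta(\mathfrak{C}')\subseteq c\ell_{\Delta'}(\mathfrak{C}')$ and $\Im(\mathfrak{C}')=\Im(c\ell_{\Delta'}(\mathfrak{C}'))$. In particular, if $\mathfrak{C}(\mathcal{M})\subseteq c\ell_{\Delta'}(\mathfrak{C}_3)$, where $\mathfrak{C}_3$ is the set of circuits with at most $3$ elements, then $\operatorname{OS}(\mathcal{M})$ is quadratic, i.e. $\Im(\mathfrak{C}(\mathcal{M}))=\Im(\mathfrak{C}_3)$.
   Context: $\mathcal{E}=\bigwedge\big(\bigoplus_{i=1}^n\mathbb{K}e_i\big)$; $e_X=e_{i_1}\wedge\dots\wedge e_{i_m}$ for $X=\{i_1<\dots<i_m\}$; $\partial$ is the degree $-1$ derivation with $\partial(e_i)=1$ and $\partial(a\wedge b)=\partial(a)\wedge b+(-1)^{\deg a}a\wedge\partial(b)$. For $\mathfrak{X}\subseteq2^{[n]}$, $\Im(\mathfrak{X})$ is the two-sided ideal of $\mathcal{E}$ generated by $\{\partial(e_X):X\in\mathfrak{X}\}$; $\operatorname{OS}(\mathcal{M})=\mathcal{E}/\Im(\mathfrak{C}(\mathcal{M}))$. A family $\mathfrak{X}\subseteq2^{[n]}$ is $\Delta$-closed if (i) $X\subseteq X'$ and $X\in\mathfrak{X}$ imply $X'\in\mathfrak{X}$; (ii)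 $X,X'\in\mathfrak{X}$, $|X|,|X'|\ge2$, $X\cap X'=\{i_\alpha\}$ imply $X\Delta X'\in\mathfrak{X}$. It is $\Delta'$-closed if (S1) $X\subseteq X'$ and $X\in\mathfrak{X}$ imply $X'\in\mathfrak{X}$; and (S3) for every $X\subseteq[n]$ with $|X|\ge2$ and every $i_\alpha\in X$, if $X\setminus\{i_\ell\}\in\mathfrak{X}$ for all $i_\ell\in X\setminus\{i_\alpha\}$ then $X\setminus\{i_\alpha\}\in\mathfrak{X}$. $c\ell_\Delta(\mathfrak{Z})$ (resp. $c\ell_{\Delta'}(\mathfrak{Z})$) is the smallest $\Delta$-closed (resp. $\Delta'$-closed) subfamily of $2^{[n]}$ containing $\mathfrak{Z}$. -}

module Defs where

open import Level using (Level; _⊔_) renaming (suc to lsuc)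
open import Algebra.Bundles using (CommutativeRing)
open import Data.Nat using (ℕ; zero; suc; _≤_)
open import Data.Bool using (Bool; true; false; not)
open import Data.Fin using (Fin)
open import Data.Vec using (Vec; []; _∷_)
open import Data.Fin.Subset
  using (Subset; inside; outside; _∈_; _⊆_; _∩_; _∪_; _─_; _-_; ∣_∣; ⁅_⁆)
  renaming (⊥ to ∅)
open import Data.Product using (Σ; ∃; _×_)
open import Relation.Nullary using (¬_; yes; no)
open import Relation.Binary.PropositionalEquality using (_≡_; _≢_)

record Field (c ℓ : Level) : Set (lsuc (c ⊔ ℓ)) where
  field
    commutativeRing : CommutativeRing c ℓ
  open CommutativeRing commutativeRing public
  field
    0≉1     : ¬ (0# ≈ 1#)
    inverse : ∀ x → ¬ (x ≈ 0#) → ∃ λ y → (x * y) ≈ 1#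

Family : ℕ → (ℓ : Level) → Set (lsuc ℓ)
Family n ℓ = Subset n → Set ℓ

_⊆F_ : ∀ {n a b} → Family n a → Family n b → Set (a ⊔ b)
𝒳 ⊆F 𝒴 = ∀ X → 𝒳 X → 𝒴 X

_Δ_ : ∀ {n} → Subset n → Subset n → Subset n
X Δ Y = (X ─ Y) ∪ (Y ─ X)

record Matroid (n : ℕ) : Set₁ where
  field
    Circuit : Family n Level.zero
    C1 : ¬ Circuit ∅
    C2 : ∀ {X Y} → Circuit X → Circuit Y → X ⊆ Y → X ≡ Y
    C3 : ∀ {X Y} {e : Fin n} → Circuit X → Circuit Y → X ≢ Y →
         e ∈ X → e ∈ Y → ∃ λ Z → Circuit Z × Z ⊆ ((X ∪ Y) - e)

-- simple: no loops and no parallel elements, i.e. every circuit has ≥ 3 elements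
Simple : ∀ {n} → Matroid n → Set
Simple M = ∀ X → Matroid.Circuit M X → 3 ≤ ∣ X ∣

Circuits≤3 : ∀ {n} → Matroid n → Family n Level.zero
Circuits≤3 M X = Matroid.Circuit M X × ∣ X ∣ ≤ 3

IsΔClosed : ∀ {n ℓ} → Family n ℓ → Set ℓ
IsΔClosed {n} 𝒳 =
  (∀ {X X'} → 𝒳 X → X ⊆ X' → 𝒳 X')
  × (∀ {X X'} {i : Fin n} → 𝒳 X → 𝒳 X' → 2 ≤ ∣ X ∣ → 2 ≤ ∣ X' ∣ →
       (X ∩ X') ≡ ⁅ i ⁆ → 𝒳 (X Δ X'))

IsΔ'Closed : ∀ {n ℓ} → Family n ℓ → Set ℓ
IsΔ'Closed {n} 𝒳 =
  (∀ {X X'} → 𝒳 X → X ⊆ X' → 𝒳 X')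
  × (∀ (X : Subset n) (i : Fin n) → 2 ≤ ∣ X ∣ → i ∈ X →
       (∀ j → j ∈ X → j ≢ i → 𝒳 (X - j)) → 𝒳 (X - i))

data clΔ {n ℓ} (𝒴 : Family n ℓ) : Subset n → Set ℓ where
  base : ∀ {X} → 𝒴 X → clΔ 𝒴 X
  up   : ∀ {X X'} → clΔ 𝒴 X → X ⊆ X' → clΔ 𝒴 X'
  symd : ∀ {X X'} {i : Fin n} → clΔ 𝒴 X → clΔ 𝒴 X' →
         2 ≤ ∣ X ∣ → 2 ≤ ∣ X' ∣ → (X ∩ X') ≡ ⁅ i ⁆ → clΔ 𝒴 (X Δ X')

data clΔ' {n ℓ} (𝒴 : Family n ℓ) : Subset n → Set ℓ where
  base : ∀ {X} → 𝒴 X → clΔ' 𝒴 X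
  up   : ∀ {X X'} → clΔ' 𝒴 X → X ⊆ X' → clΔ' 𝒴 X'
  s3   : ∀ (X : Subset n) (i : Fin n) → 2 ≤ ∣ X ∣ → i ∈ X →
         (∀ j → j ∈ X → j ≢ i → clΔ' 𝒴 (X - j)) → clΔ' 𝒴 (X - i)

-- An element is its coefficient function on the basis {e_X : X ⊆ [n]}
-- (Fin index 0 is e_1, the smallest generator).  The product is defined
-- by recursion on n via  ⋀(K e_0 ⊕ V) = ⋀V ⊕ e_0 ∧ ⋀V :
--   (A + e_0 B) ∧ (C + e_0 D) = A ∧ C + e_0 ∧ (ι(A) ∧ D + B ∧ C),
-- where ι is the grade involution (using e_0 ∧ e_0 = 0 and A e_0 = e_0 ι(A)).

module Exterior {c ℓ} (R : CommutativeRing c ℓ) where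
  open CommutativeRing R using (Carrier; _≈_; _+_; _*_; -_; 0#; 1#)

  Ext : ℕ → Set c
  Ext n = Subset n → Carrier

  _≋_ : ∀ {n} → Ext n → Ext n → Set ℓ
  a ≋ b = ∀ X → a X ≈ b X

  0ᴱ : ∀ {n} → Ext n
  0ᴱ _ = 0#

  _+ᴱ_ : ∀ {n} → Ext n → Ext n → Ext n
  (a +ᴱ b) X = a X + b X

  odd : ∀ {n} → Subset n → Bool
  odd []            = false
  odd (outside ∷ X) = odd X
  odd (inside  ∷ X) = not (odd X)

  ι : ∀ {n} → Ext n → Ext n
  ι a X with odd X
  ... | false = a X
  ... | true  = - a X

  _∧_ : ∀ {n} → Ext n → Ext n → Ext n
  _∧_ {zero}  a b []            = a [] * b []
  _∧_ {suc n} a b (outside ∷ Y) = ((λ Z → a (outside ∷ Z)) ∧ (λ Z → b (outside ∷ Z))) Y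
  _∧_ {suc n} a b (inside  ∷ Y) =
    (ι (λ Z → a (outside ∷ Z)) ∧ (λ Z → b (inside ∷ Z))) Y
    + ((λ Z → a (inside ∷ Z)) ∧ (λ Z → b (outside ∷ Z))) Y

  e : ∀ {n} → Subset n → Ext n
  e [] []                        = 1#
  e (outside ∷ X) (outside ∷ Y) = e X Y
  e (outside ∷ X) (inside  ∷ Y) = 0#
  e (inside  ∷ X) (outside ∷ Y) = 0#
  e (inside  ∷ X) (inside  ∷ Y) = e X Y

  -- ∂(e_X), computed from ∂(e_i) = 1, ∂(1) = 0 and the graded Leibniz rule:
  --   ∂(e_0 ∧ e_X) = e_X − e_0 ∧ ∂(e_X),   and ∂ commutes with the inclusion
  --   ⋀V ↪ ⋀(K e_0 ⊕ V).
  ∂e : ∀ {n} → Subset n → Ext n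
  ∂e [] []                        = 0#
  ∂e (outside ∷ X) (outside ∷ Y) = ∂e X Y
  ∂e (outside ∷ X) (inside  ∷ Y) = 0#
  ∂e (inside  ∷ X) (outside ∷ Y) = e X Y
  ∂e (inside  ∷ X) (inside  ∷ Y) = - ∂e X Y

  data Ideal {n a} (𝒳 : Family n a) : Ext n → Set (c ⊔ ℓ ⊔ a) where
    gen   : ∀ {X} → 𝒳 X → Ideal 𝒳 (∂e X)
    zer   : Ideal 𝒳 0ᴱ
    add   : ∀ {x y} → Ideal 𝒳 x → Ideal 𝒳 y → Ideal 𝒳 (x +ᴱ y)
    mulˡ  : ∀ {x} (z : Ext n) → Ideal 𝒳 x → Ideal 𝒳 (z ∧ x)
    mulʳ  : ∀ {x} (z : Ext n) → Ideal 𝒳 x → Ideal 𝒳 (x ∧ z)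
    resp  : ∀ {x y} → x ≋ y → Ideal 𝒳 x → Ideal 𝒳 y

  _≐_ : ∀ {n a b} → (Ext n → Set a) → (Ext n → Set b) → Set (c ⊔ a ⊔ b)
  I ≐ J = (∀ x → I x → J x) × (∀ x → J x → I x)

{-# OPTIONS --safe #-}
-- Every Δ'-closed family is Δ-closed: when X ∩ X' = {i}, each (X ∪ X') − j with j ≠ i
-- contains X or X', so (S3) gives (X ∪ X') − i ⊆ X Δ X'; minimality of cℓ_Δ does the rest.
-- Both rules generating cℓ_Δ' keep ∂e_X inside the ideal.  For i ∈ X one has
-- e_X = e_i ∧ ∂e_X, so by the Leibniz rule ∂e_{X ∪ {k}} = ±(e_X − e_k ∧ ∂e_X) is in the
-- ideal (S1); and ∂∂e_X = Σ_j ±∂e_{X − j} = 0 puts ∂e_{X − i} in the ideal once all other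
-- ∂e_{X − j} are (S3).  The (S1) step needs some i ∈ X, which simplicity provides for circuits.
module Submission where

open import Defs
import Level
open import Algebra.Bundles using (CommutativeRing)
import Algebra.Properties.Group as GroupProperties
import Algebra.Properties.Ring as RingProperties
open import Data.Bool using (true; false)
open import Data.Bool.Properties using (not-injective)
open import Data.Fin using (Fin; zero; suc)
open import Data.Fin.Properties using (suc-injective)
open import Data.Fin.Subset
  using (Subset; inside; outside; _∈_; _∉_; _⊆_; _∩_; _∪_; _─_; _-_; ∣_∣; ⁅_⁆; Nonempty)
open import Data.Fin.Subset.Properties
  using ( x∈⁅x⁆; x∈⁅y⁆⇒x≡y; x∉⁅y⁆⇒x≢y; x∈p∩q⁺; x∈p∩q⁻; p⊆p∪q; q⊆p∪q; x∈p∪q⁺; x∈p∪q⁻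
        ; ∣p∣≤∣p∪q∣; ∣⊥∣≡0; x∈p∧x∉q⇒x∈p─q; x∈p∧x≢y⇒x∈p-y; p─q⊆p; p─⊥≡p
        ; drop-∷-⊆; nonempty?; Empty-unique)
open import Data.Nat using (ℕ; suc; _≤_; _<_; s≤s; z≤n)
open import Data.Nat.Properties using (≤-trans; >⇒≢)
open import Data.Product using (_×_; _,_; proj₁; proj₂; ∃)
open import Data.Sum using (inj₁; inj₂)
open import Data.Vec using ([]; _∷_; _[_]≔_; _[_]=_; here; there)
open import Function using (_∘_; flip)
open import Relation.Binary.Construct.Closure.ReflexiveTransitive using (Star; ε; _◅_; gmap)
open import Relation.Nullary using (yes; no; contradiction)
import Relation.Binary.PropositionalEquality as ≡
open ≡ using (_≡_; _≢_)

0<∣p∣⇒Nonempty : ∀ {n} {p : Subset n} → 0 < ∣ p ∣ → Nonempty p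
0<∣p∣⇒Nonempty {n} {p} 0<∣p∣ with nonempty? p
... | yes p≢∅ = p≢∅
... | no  p≡∅ = contradiction (≡.trans (≡.cong ∣_∣ (Empty-unique p≡∅)) (∣⊥∣≡0 n)) (>⇒≢ 0<∣p∣)

2≤∣p∣⇒∃-∈-≢ : ∀ {n} {p : Subset n} {x} → 2 ≤ ∣ p ∣ → x ∈ p → ∃ λ y → y ∈ p × y ≢ x
2≤∣p∣⇒∃-∈-≢ {p = inside ∷ p} (s≤s 1≤∣p∣) here with 0<∣p∣⇒Nonempty 1≤∣p∣
... | y , y∈p = suc y , there y∈p , λ ()
2≤∣p∣⇒∃-∈-≢ {p = inside ∷ p} _ (there _) = zero , here , λ ()
2≤∣p∣⇒∃-∈-≢ {p = outside ∷ p} 2≤∣p∣ (there x∈p) with 2≤∣p∣⇒∃-∈-≢ 2≤∣p∣ x∈p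
... | y , y∈p , y≢x = suc y , there y∈p , y≢x ∘ suc-injective

2≤∣p∣⇒Nonempty[p-x] : ∀ {n} {p : Subset n} {x} → 2 ≤ ∣ p ∣ → x ∈ p → Nonempty (p - x)
2≤∣p∣⇒Nonempty[p-x] 2≤∣p∣ x∈p with 2≤∣p∣⇒∃-∈-≢ 2≤∣p∣ x∈p
... | y , y∈p , y≢x = y , x∈p∧x≢y⇒x∈p-y y∈p y≢x

x∈p─q⇒x∉q : ∀ {n} {x : Fin n} (p q : Subset n) → x ∈ p ─ q → x ∉ q
x∈p─q⇒x∉q (inside  ∷ p) (outside ∷ q) here ()
x∈p─q⇒x∉q (_       ∷ p) (_       ∷ q) (there x∈p─q) (there x∈q) = x∈p─q⇒x∉q p q x∈p─q x∈q

x∈p-y⇒x≢y : ∀ {n} {p : Subset n} {x y} → x ∈ p - y → x ≢ y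
x∈p-y⇒x≢y {p = p} {y = y} = x∉⁅y⁆⇒x≢y ∘ x∈p─q⇒x∉q p ⁅ y ⁆

p⊆q∧x∉p⇒p⊆q-x : ∀ {n} {p q : Subset n} {x} → p ⊆ q → x ∉ p → p ⊆ q - x
p⊆q∧x∉p⇒p⊆q-x p⊆q x∉p y∈p = x∈p∧x≢y⇒x∈p-y (p⊆q y∈p) λ { ≡.refl → x∉p y∈p }

p-x≡p[x]≔outside : ∀ {n} (p : Subset n) x → p - x ≡ p [ x ]≔ outside
p-x≡p[x]≔outside (_ ∷ p) zero    = ≡.cong (outside ∷_) (p─⊥≡p p)
p-x≡p[x]≔outside (s ∷ p) (suc x) = ≡.cong (s ∷_) (p-x≡p[x]≔outside p x)

data _⋖_ {n} : Subset n → Subset n → Set where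
  cover : ∀ {X k} → X [ k ]= outside → X ⋖ (X [ k ]≔ inside)

∷-⋖ : ∀ {n} {X Y : Subset n} {s} → X ⋖ Y → (s ∷ X) ⋖ (s ∷ Y)
∷-⋖ (cover k∉X) = cover (there k∉X)

⋖⇒⊆ : ∀ {n} {X Y : Subset n} → X ⋖ Y → X ⊆ Y
⋖⇒⊆ (cover here)        (there x∈X)  = there x∈X
⋖⇒⊆ (cover (there k∉X)) here         = here
⋖⇒⊆ (cover (there k∉X)) (there x∈X)  = there (⋖⇒⊆ (cover k∉X) x∈X)

⊆⇒⋖* : ∀ {n} {X Y : Subset n} → X ⊆ Y → Star _⋖_ X Y
⊆⇒⋖* {X = []}          {[]}          _   = ε
⊆⇒⋖* {X = outside ∷ X} {outside ∷ Y} X⊆Y = gmap (outside ∷_) ∷-⋖ (⊆⇒⋖* (drop-∷-⊆ X⊆Y))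
⊆⇒⋖* {X = inside  ∷ X} {inside  ∷ Y} X⊆Y = gmap (inside ∷_) ∷-⋖ (⊆⇒⋖* (drop-∷-⊆ X⊆Y))
⊆⇒⋖* {X = outside ∷ X} {inside  ∷ Y} X⊆Y =
  cover here ◅ gmap (inside ∷_) ∷-⋖ (⊆⇒⋖* (drop-∷-⊆ X⊆Y))
⊆⇒⋖* {X = inside  ∷ X} {outside ∷ Y} X⊆Y = contradiction (X⊆Y here) λ ()

module _ {n} {X X' : Subset n} {i} (X∩X'≡⁅i⁆ : X ∩ X' ≡ ⁅ i ⁆) where

  ∈-both⇒≡ : ∀ {j} → j ∈ X → j ∈ X' → j ≡ i
  ∈-both⇒≡ j∈X j∈X' = x∈⁅y⁆⇒x≡y i (≡.subst (_ ∈_) X∩X'≡⁅i⁆ (x∈p∩q⁺ (j∈X , j∈X')))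

  ∈-both : i ∈ X × i ∈ X'
  ∈-both = x∈p∩q⁻ X X' (≡.subst (i ∈_) (≡.sym X∩X'≡⁅i⁆) (x∈⁅x⁆ i))

  [p∪q]-x⊆pΔq : (X ∪ X') - i ⊆ X Δ X'
  [p∪q]-x⊆pΔq {z} z∈ with x∈p∪q⁻ X X' (p─q⊆p (X ∪ X') ⁅ i ⁆ z∈)
  ... | inj₁ z∈X  = x∈p∪q⁺ (inj₁ (x∈p∧x∉q⇒x∈p─q z∈X  (x∈p-y⇒x≢y z∈ ∘ ∈-both⇒≡ z∈X)))
  ... | inj₂ z∈X' = x∈p∪q⁺ (inj₂ (x∈p∧x∉q⇒x∈p─q z∈X' (x∈p-y⇒x≢y z∈ ∘ flip ∈-both⇒≡ z∈X')))

Δ'-closed⇒Δ-closed : ∀ {n ℓ} {𝒳 : Family n ℓ} → IsΔ'Closed 𝒳 → IsΔClosed 𝒳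
Δ'-closed⇒Δ-closed {𝒳 = 𝒳} (upward , dropping) = upward , Δ-step
  where
  Δ-step : ∀ {X X' i} → 𝒳 X → 𝒳 X' → 2 ≤ ∣ X ∣ → 2 ≤ ∣ X' ∣ → X ∩ X' ≡ ⁅ i ⁆ → 𝒳 (X Δ X')
  Δ-step {X} {X'} {i} 𝒳X 𝒳X' 2≤∣X∣ _ X∩X'≡⁅i⁆ =
    upward (dropping (X ∪ X') i 2≤∣X∪X'∣ (p⊆p∪q X' (proj₁ (∈-both X∩X'≡⁅i⁆))) drop-other)
       ([p∪q]-x⊆pΔq X∩X'≡⁅i⁆)
    where
    2≤∣X∪X'∣ : 2 ≤ ∣ X ∪ X' ∣
    2≤∣X∪X'∣ = ≤-trans 2≤∣X∣ (∣p∣≤∣p∪q∣ X X')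
    drop-other : ∀ j → j ∈ X ∪ X' → j ≢ i → 𝒳 ((X ∪ X') - j)
    drop-other j j∈X∪X' j≢i with x∈p∪q⁻ X X' j∈X∪X'
    ... | inj₁ j∈X  = upward 𝒳X' (p⊆q∧x∉p⇒p⊆q-x (q⊆p∪q X X') (j≢i ∘ ∈-both⇒≡ X∩X'≡⁅i⁆ j∈X))
    ... | inj₂ j∈X' = upward 𝒳X  (p⊆q∧x∉p⇒p⊆q-x (p⊆p∪q X') (j≢i ∘ flip (∈-both⇒≡ X∩X'≡⁅i⁆) j∈X'))

clΔ'-isΔ'Closed : ∀ {n ℓ} {𝒴 : Family n ℓ} → IsΔ'Closed (clΔ' 𝒴)
clΔ'-isΔ'Closed = up , s3

clΔ-least : ∀ {n ℓ ℓ'} {𝒴 : Family n ℓ} {𝒳 : Family n ℓ'} → IsΔClosed 𝒳 → 𝒴 ⊆F 𝒳 → clΔ 𝒴 ⊆F 𝒳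
clΔ-least closed 𝒴⊆𝒳 X (base 𝒴X)             = 𝒴⊆𝒳 X 𝒴X
clΔ-least closed 𝒴⊆𝒳 X (up d X₀⊆X)            = proj₁ closed (clΔ-least closed 𝒴⊆𝒳 _ d) X₀⊆X
clΔ-least closed 𝒴⊆𝒳 X (symd d d' 2≤ 2≤' eq) =
  proj₂ closed (clΔ-least closed 𝒴⊆𝒳 _ d) (clΔ-least closed 𝒴⊆𝒳 _ d') 2≤ 2≤' eq

clΔ⊆clΔ' : ∀ {n ℓ} {𝒴 : Family n ℓ} → clΔ 𝒴 ⊆F clΔ' 𝒴
clΔ⊆clΔ' = clΔ-least (Δ'-closed⇒Δ-closed clΔ'-isΔ'Closed) (λ _ → base)

clΔ'-nonempty : ∀ {n ℓ} {𝒴 : Family n ℓ} → (∀ X → 𝒴 X → Nonempty X) →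
                ∀ {X} → clΔ' 𝒴 X → Nonempty X
clΔ'-nonempty 𝒴-nonempty (base 𝒴X)          = 𝒴-nonempty _ 𝒴X
clΔ'-nonempty 𝒴-nonempty (up d X₀⊆X)         with clΔ'-nonempty 𝒴-nonempty d
... | x , x∈X₀ = x , X₀⊆X x∈X₀
clΔ'-nonempty 𝒴-nonempty (s3 X i 2≤∣X∣ i∈X _) = 2≤∣p∣⇒Nonempty[p-x] 2≤∣X∣ i∈X

module ExteriorCalculus {c ℓ} (R : CommutativeRing c ℓ) where
  open CommutativeRing R hiding (zero; _-_)
  open RingProperties ring
    using (-0#≈0#; -‿involutive; -‿+-comm; -‿distribˡ-*; -‿distribʳ-*; -1*x≈-x)
  open GroupProperties +-group using (\\-leftDividesʳ; //-rightDividesʳ)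
  open Exterior R
  open import Relation.Binary.Reasoning.Setoid setoid

  -ᴱ_ : ∀ {n} → Ext n → Ext n
  (-ᴱ a) Y = - a Y

  _·ᴱ_ : ∀ {n} → Carrier → Ext n → Ext n
  (c ·ᴱ a) Y = c * a Y

  -- the components A and B of a = A + e₀ ∧ B
  tail⁻ tail⁺ : ∀ {n} → Ext (suc n) → Ext n
  tail⁻ a Y = a (outside ∷ Y)
  tail⁺ a Y = a (inside ∷ Y)

  scalar : ∀ {n} → Carrier → Ext n
  scalar c []            = c
  scalar c (outside ∷ Y) = scalar c Y
  scalar c (inside  ∷ Y) = 0#

  scalar-0# : ∀ {n} → scalar {n} 0# ≋ 0ᴱ
  scalar-0# []            = refl
  scalar-0# (outside ∷ Y) = scalar-0# Y
  scalar-0# (inside  ∷ Y) = refl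

  -‿scalar : ∀ {n} c (Y : Subset n) → - scalar c Y ≈ scalar (- c) Y
  -‿scalar c []            = refl
  -‿scalar c (outside ∷ Y) = -‿scalar c Y
  -‿scalar c (inside  ∷ Y) = -0#≈0#

  scalar-odd : ∀ {n} c (Y : Subset n) → odd Y ≡ true → scalar c Y ≈ 0#
  scalar-odd c (outside ∷ Y) odd≡true = scalar-odd c Y odd≡true
  scalar-odd c (inside  ∷ Y) _        = refl

  ι-scalar : ∀ {n} {a : Ext n} {c} → a ≋ scalar c → ι a ≋ scalar c
  ι-scalar a≋c Y with odd Y in odd≡true
  ... | false = a≋c Y
  ... | true  = trans (-‿cong (trans (a≋c Y) (scalar-odd _ Y odd≡true)))
                      (trans -0#≈0# (sym (scalar-odd _ Y odd≡true)))

  ι-zero : ∀ {n} {a : Ext n} → a ≋ 0ᴱ → ι a ≋ 0ᴱ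
  ι-zero a≋0 Y = trans (ι-scalar (λ Z → trans (a≋0 Z) (sym (scalar-0# Z))) Y) (scalar-0# Y)

  ∧-scalarˡ : ∀ {n} {a : Ext n} {c} → a ≋ scalar c → ∀ x → (a ∧ x) ≋ (c ·ᴱ x)
  ∧-scalarˡ a≋c x []            = *-congʳ (a≋c [])
  ∧-scalarˡ a≋c x (outside ∷ Y) = ∧-scalarˡ (a≋c ∘ (outside ∷_)) (tail⁻ x) Y
  ∧-scalarˡ {a = a} a≋c x (inside ∷ Y) =
    trans (+-cong (∧-scalarˡ (ι-scalar (a≋c ∘ (outside ∷_))) (tail⁺ x) Y)
                  (∧-scalarˡ tail⁺a≋0 (tail⁻ x) Y))
          (trans (+-congˡ (zeroˡ _)) (+-identityʳ _))
    where
    tail⁺a≋0 : tail⁺ a ≋ scalar 0#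
    tail⁺a≋0 Z = trans (a≋c (inside ∷ Z)) (sym (scalar-0# Z))

  ∧-zeroˡ : ∀ {n} {a : Ext n} → a ≋ 0ᴱ → ∀ x → (a ∧ x) ≋ 0ᴱ
  ∧-zeroˡ a≋0 x Y = trans (∧-scalarˡ (λ Z → trans (a≋0 Z) (sym (scalar-0# Z))) x Y) (zeroˡ _)

  _·e⁅_⁆ : ∀ {n} → Carrier → Fin n → Ext n
  (c ·e⁅ zero  ⁆) (outside ∷ Y) = 0#
  (c ·e⁅ zero  ⁆) (inside  ∷ Y) = scalar c Y
  (c ·e⁅ suc k ⁆) (outside ∷ Y) = (c ·e⁅ k ⁆) Y
  (c ·e⁅ suc k ⁆) (inside  ∷ Y) = 0#

  ·e⁅⁆-even : ∀ {n} c k (Y : Subset n) → odd Y ≡ false → (c ·e⁅ k ⁆) Y ≈ 0#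
  ·e⁅⁆-even c zero    (outside ∷ Y) _         = refl
  ·e⁅⁆-even c zero    (inside  ∷ Y) odd≡false = scalar-odd c Y (not-injective odd≡false)
  ·e⁅⁆-even c (suc k) (outside ∷ Y) odd≡false = ·e⁅⁆-even c k Y odd≡false
  ·e⁅⁆-even c (suc k) (inside  ∷ Y) _         = refl

  -‿·e⁅⁆ : ∀ {n} c k (Y : Subset n) → - (c ·e⁅ k ⁆) Y ≈ ((- c) ·e⁅ k ⁆) Y
  -‿·e⁅⁆ c zero    (outside ∷ Y) = -0#≈0#
  -‿·e⁅⁆ c zero    (inside  ∷ Y) = -‿scalar c Y
  -‿·e⁅⁆ c (suc k) (outside ∷ Y) = -‿·e⁅⁆ c k Y
  -‿·e⁅⁆ c (suc k) (inside  ∷ Y) = -0#≈0#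

  ι-·e⁅⁆ : ∀ {n} {a : Ext n} {c} k → a ≋ (c ·e⁅ k ⁆) → ι a ≋ ((- c) ·e⁅ k ⁆)
  ι-·e⁅⁆ {c = c} k a≋ Y with odd Y in odd≡
  ... | false = trans (a≋ Y) (trans (·e⁅⁆-even c k Y odd≡) (sym (·e⁅⁆-even (- c) k Y odd≡)))
  ... | true  = trans (-‿cong (a≋ Y)) (-‿·e⁅⁆ c k Y)

  -- the coefficients of (c ·e⁅ k ⁆ ∧ x): e_k anticommutes past each element of Y below k
  lmul : ∀ {n} → Fin n → Carrier → Ext n → Ext n
  lmul zero    c x (outside ∷ Y) = 0#
  lmul zero    c x (inside  ∷ Y) = c * x (outside ∷ Y)
  lmul (suc k) c x (outside ∷ Y) = lmul k c (tail⁻ x) Y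
  lmul (suc k) c x (inside  ∷ Y) = lmul k (- c) (tail⁺ x) Y

  ∧-·e⁅⁆ : ∀ {n} {a : Ext n} {c} k → a ≋ (c ·e⁅ k ⁆) → ∀ x → (a ∧ x) ≋ lmul k c x
  ∧-·e⁅⁆ zero    a≋ x (outside ∷ Y) = ∧-zeroˡ (a≋ ∘ (outside ∷_)) (tail⁻ x) Y
  ∧-·e⁅⁆ zero    a≋ x (inside  ∷ Y) =
    trans (+-cong (∧-zeroˡ (ι-zero (a≋ ∘ (outside ∷_))) (tail⁺ x) Y)
                  (∧-scalarˡ (a≋ ∘ (inside ∷_)) (tail⁻ x) Y))
          (+-identityˡ _)
  ∧-·e⁅⁆ (suc k) a≋ x (outside ∷ Y) = ∧-·e⁅⁆ k (a≋ ∘ (outside ∷_)) (tail⁻ x) Y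
  ∧-·e⁅⁆ (suc k) a≋ x (inside  ∷ Y) =
    trans (+-cong (∧-·e⁅⁆ k (ι-·e⁅⁆ k (a≋ ∘ (outside ∷_))) (tail⁺ x) Y)
                  (∧-zeroˡ (a≋ ∘ (inside ∷_)) (tail⁻ x) Y))
          (+-identityʳ _)

  lmul-congˡ : ∀ {n} k {c c'} (x : Ext n) → c ≈ c' → lmul k c x ≋ lmul k c' x
  lmul-congˡ zero    x c≈c' (outside ∷ Y) = refl
  lmul-congˡ zero    x c≈c' (inside  ∷ Y) = *-congʳ c≈c'
  lmul-congˡ (suc k) x c≈c' (outside ∷ Y) = lmul-congˡ k (tail⁻ x) c≈c' Y
  lmul-congˡ (suc k) x c≈c' (inside  ∷ Y) = lmul-congˡ k (tail⁺ x) (-‿cong c≈c') Y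

  lmul-negˡ : ∀ {n} k c (x : Ext n) → lmul k (- c) x ≋ (-ᴱ lmul k c x)
  lmul-negˡ zero    c x (outside ∷ Y) = sym -0#≈0#
  lmul-negˡ zero    c x (inside  ∷ Y) = sym (-‿distribˡ-* c _)
  lmul-negˡ (suc k) c x (outside ∷ Y) = lmul-negˡ k c (tail⁻ x) Y
  lmul-negˡ (suc k) c x (inside  ∷ Y) = lmul-negˡ k (- c) (tail⁺ x) Y

  lmul-negʳ : ∀ {n} k c (x : Ext n) → lmul k c (-ᴱ x) ≋ (-ᴱ lmul k c x)
  lmul-negʳ zero    c x (outside ∷ Y) = sym -0#≈0#
  lmul-negʳ zero    c x (inside  ∷ Y) = sym (-‿distribʳ-* c _)
  lmul-negʳ (suc k) c x (outside ∷ Y) = lmul-negʳ k c (tail⁻ x) Y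
  lmul-negʳ (suc k) c x (inside  ∷ Y) = lmul-negʳ k (- c) (tail⁺ x) Y

  lmul-zeroʳ : ∀ {n} (k : Fin n) c → lmul k c 0ᴱ ≋ 0ᴱ
  lmul-zeroʳ zero    c (outside ∷ Y) = refl
  lmul-zeroʳ zero    c (inside  ∷ Y) = zeroʳ c
  lmul-zeroʳ (suc k) c (outside ∷ Y) = lmul-zeroʳ k c Y
  lmul-zeroʳ (suc k) c (inside  ∷ Y) = lmul-zeroʳ k (- c) Y

  lmul-e : ∀ {n} {k} {X : Subset n} → k ∈ X → ∀ c → lmul k c (e X) ≋ 0ᴱ
  lmul-e here c (outside ∷ Y) = refl
  lmul-e here c (inside  ∷ Y) = zeroʳ c
  lmul-e {k = suc k} {outside ∷ X} (there k∈X) c (outside ∷ Y) = lmul-e k∈X c Y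
  lmul-e {k = suc k} {outside ∷ X} (there k∈X) c (inside  ∷ Y) = lmul-zeroʳ k (- c) Y
  lmul-e {k = suc k} {inside  ∷ X} (there k∈X) c (outside ∷ Y) = lmul-zeroʳ k c Y
  lmul-e {k = suc k} {inside  ∷ X} (there k∈X) c (inside  ∷ Y) = lmul-e k∈X (- c) Y

  e≋lmul-∂e : ∀ {n} {k} {X : Subset n} → k ∈ X → e X ≋ lmul k 1# (∂e X)
  e≋lmul-∂e here (outside ∷ Y) = refl
  e≋lmul-∂e here (inside  ∷ Y) = sym (*-identityˡ _)
  e≋lmul-∂e {k = suc k} {outside ∷ X} (there k∈X) (outside ∷ Y) = e≋lmul-∂e k∈X Y
  e≋lmul-∂e {k = suc k} {outside ∷ X} (there k∈X) (inside  ∷ Y) = sym (lmul-zeroʳ k (- 1#) Y)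
  e≋lmul-∂e {k = suc k} {inside  ∷ X} (there k∈X) (outside ∷ Y) = sym (lmul-e k∈X 1# Y)
  e≋lmul-∂e {k = suc k} {inside  ∷ X} (there k∈X) (inside  ∷ Y) = begin
    e X Y                          ≈⟨ e≋lmul-∂e k∈X Y ⟩
    lmul k 1# (∂e X) Y             ≈⟨ -‿involutive _ ⟨
    - - lmul k 1# (∂e X) Y         ≈⟨ -‿cong (lmul-negˡ k 1# (∂e X) Y) ⟨
    - lmul k (- 1#) (∂e X) Y       ≈⟨ lmul-negʳ k (- 1#) (∂e X) Y ⟨
    lmul k (- 1#) (-ᴱ ∂e X) Y      ∎

  e≋e⁅k⁆∧∂e : ∀ {n} {k} {X : Subset n} → k ∈ X → e X ≋ ((1# ·e⁅ k ⁆) ∧ ∂e X)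
  e≋e⁅k⁆∧∂e {k = k} k∈X Y = trans (e≋lmul-∂e k∈X Y) (sym (∧-·e⁅⁆ k (λ _ → refl) _ Y))

  sign : ∀ {n} → Fin n → Subset n → Carrier
  sign zero    _             = 1#
  sign (suc k) (outside ∷ X) = sign k X
  sign (suc k) (inside  ∷ X) = - sign k X

  e-insert : ∀ {n} {k} {X : Subset n} → X [ k ]= outside →
             e (X [ k ]≔ inside) ≋ lmul k (sign k X) (e X)
  e-insert here (outside ∷ Y) = refl
  e-insert here (inside  ∷ Y) = sym (*-identityˡ _)
  e-insert {k = suc k} {outside ∷ X} (there k∉X) (outside ∷ Y) = e-insert k∉X Y
  e-insert {k = suc k} {outside ∷ X} (there k∉X) (inside  ∷ Y) = sym (lmul-zeroʳ k _ Y)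
  e-insert {k = suc k} {inside  ∷ X} (there k∉X) (outside ∷ Y) = sym (lmul-zeroʳ k _ Y)
  e-insert {k = suc k} {inside  ∷ X} (there k∉X) (inside  ∷ Y) =
    trans (e-insert k∉X Y) (lmul-congˡ k (e X) (sym (-‿involutive _)) Y)

  ∂e-insert : ∀ {n} {k} {X : Subset n} → X [ k ]= outside →
              ∂e (X [ k ]≔ inside) ≋ ((sign k X ·ᴱ e X) +ᴱ lmul k (- sign k X) (∂e X))
  ∂e-insert here (outside ∷ Y) = sym (trans (+-identityʳ _) (*-identityˡ _))
  ∂e-insert here (inside  ∷ Y) = sym (trans (+-cong (zeroʳ 1#) (-1*x≈-x _)) (+-identityˡ _))
  ∂e-insert {k = suc k} {outside ∷ X} (there k∉X) (outside ∷ Y) = ∂e-insert k∉X Y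
  ∂e-insert {k = suc k} {outside ∷ X} (there k∉X) (inside  ∷ Y) =
    sym (trans (+-cong (zeroʳ _) (lmul-zeroʳ k _ Y)) (+-identityʳ 0#))
  ∂e-insert {k = suc k} {inside  ∷ X} (there k∉X) (outside ∷ Y) = begin
    e (X [ k ]≔ inside) Y                      ≈⟨ e-insert k∉X Y ⟩
    lmul k σ (e X) Y                           ≈⟨ lmul-congˡ k (e X) (-‿involutive σ) Y ⟨
    lmul k (- - σ) (e X) Y                     ≈⟨ +-identityˡ _ ⟨
    0# + lmul k (- - σ) (e X) Y                ≈⟨ +-congʳ (zeroʳ (- σ)) ⟨
    - σ * 0# + lmul k (- - σ) (e X) Y          ∎
    where
    σ : Carrier
    σ = sign k X
  ∂e-insert {k = suc k} {inside  ∷ X} (there k∉X) (inside  ∷ Y) = begin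
    - ∂e (X [ k ]≔ inside) Y
      ≈⟨ -‿cong (∂e-insert k∉X Y) ⟩
    - (σ * e X Y + lmul k (- σ) (∂e X) Y)
      ≈⟨ -‿+-comm _ _ ⟨
    - (σ * e X Y) + - lmul k (- σ) (∂e X) Y
      ≈⟨ +-cong (-‿distribˡ-* σ _) (sym (lmul-negʳ k (- σ) (∂e X) Y)) ⟩
    - σ * e X Y + lmul k (- σ) (-ᴱ ∂e X) Y
      ≈⟨ +-congˡ (lmul-congˡ k (-ᴱ ∂e X) (-‿involutive (- σ)) Y) ⟨
    - σ * e X Y + lmul k (- - - σ) (-ᴱ ∂e X) Y
      ∎
    where
    σ : Carrier
    σ = sign k X

  altSum : ∀ {n} → Subset n → (Fin n → Carrier) → Carrier
  altSum []            f = 0#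
  altSum (outside ∷ X) f = altSum X (f ∘ suc)
  altSum (inside  ∷ X) f = f zero + - altSum X (f ∘ suc)

  altSum-0# : ∀ {n} (X : Subset n) → altSum X (λ _ → 0#) ≈ 0#
  altSum-0# []            = refl
  altSum-0# (outside ∷ X) = altSum-0# X
  altSum-0# (inside  ∷ X) = trans (+-identityˡ _) (trans (-‿cong (altSum-0# X)) -0#≈0#)

  altSum-neg : ∀ {n} (X : Subset n) f → altSum X (λ j → - f j) ≈ - altSum X f
  altSum-neg []            f = sym -0#≈0#
  altSum-neg (outside ∷ X) f = altSum-neg X (f ∘ suc)
  altSum-neg (inside  ∷ X) f = trans (+-congˡ (-‿cong (altSum-neg X (f ∘ suc)))) (-‿+-comm _ _)

  ∂e≈altSum-e : ∀ {n} (X Y : Subset n) → ∂e X Y ≈ altSum X (λ j → e (X [ j ]≔ outside) Y)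
  ∂e≈altSum-e []            []            = refl
  ∂e≈altSum-e (outside ∷ X) (outside ∷ Y) = ∂e≈altSum-e X Y
  ∂e≈altSum-e (outside ∷ X) (inside  ∷ Y) = sym (altSum-0# X)
  ∂e≈altSum-e (inside  ∷ X) (outside ∷ Y) =
    sym (trans (+-congˡ (trans (-‿cong (altSum-0# X)) -0#≈0#)) (+-identityʳ _))
  ∂e≈altSum-e (inside  ∷ X) (inside  ∷ Y) =
    sym (trans (+-identityˡ _) (-‿cong (sym (∂e≈altSum-e X Y))))

  altSum-∂e≈0# : ∀ {n} (X Y : Subset n) → altSum X (λ j → ∂e (X [ j ]≔ outside) Y) ≈ 0#
  altSum-∂e≈0# []            []            = refl
  altSum-∂e≈0# (outside ∷ X) (outside ∷ Y) = altSum-∂e≈0# X Y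
  altSum-∂e≈0# (outside ∷ X) (inside  ∷ Y) = altSum-0# X
  altSum-∂e≈0# (inside  ∷ X) (outside ∷ Y) =
    trans (+-congˡ (-‿cong (sym (∂e≈altSum-e X Y)))) (-‿inverseʳ _)
  altSum-∂e≈0# (inside  ∷ X) (inside  ∷ Y) =
    trans (+-identityˡ _)
          (trans (-‿cong (altSum-neg X _)) (trans (-‿involutive _) (altSum-∂e≈0# X Y)))

  altSumᴱ : ∀ {k n} → Subset k → (Fin k → Ext n) → Ext n
  altSumᴱ X F Y = altSum X (λ j → F j Y)

  Ideal-⊆ : ∀ {n a b} {𝒳 : Family n a} {𝒴 : Family n b} →
            (∀ {X} → 𝒴 X → Ideal 𝒳 (∂e X)) → ∀ x → Ideal 𝒴 x → Ideal 𝒳 x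
  Ideal-⊆ 𝒴⊆I x (gen 𝒴X)     = 𝒴⊆I 𝒴X
  Ideal-⊆ 𝒴⊆I x zer          = zer
  Ideal-⊆ 𝒴⊆I x (add I J)    = add (Ideal-⊆ 𝒴⊆I _ I) (Ideal-⊆ 𝒴⊆I _ J)
  Ideal-⊆ 𝒴⊆I x (mulˡ z I)   = mulˡ z (Ideal-⊆ 𝒴⊆I _ I)
  Ideal-⊆ 𝒴⊆I x (mulʳ z I)   = mulʳ z (Ideal-⊆ 𝒴⊆I _ I)
  Ideal-⊆ 𝒴⊆I x (resp x≋y I) = resp x≋y (Ideal-⊆ 𝒴⊆I _ I)

  Ideal-mono : ∀ {n a b} {𝒳 : Family n a} {𝒴 : Family n b} → 𝒴 ⊆F 𝒳 → ∀ x → Ideal 𝒴 x → Ideal 𝒳 x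
  Ideal-mono 𝒴⊆𝒳 = Ideal-⊆ (gen ∘ 𝒴⊆𝒳 _)

  module _ {n a} {𝒳 : Family n a} where

    Ideal-scale : ∀ c {x : Ext n} → Ideal 𝒳 x → Ideal 𝒳 (c ·ᴱ x)
    Ideal-scale c I = resp (∧-scalarˡ (λ _ → refl) _) (mulˡ (scalar c) I)

    Ideal-neg : ∀ {x : Ext n} → Ideal 𝒳 x → Ideal 𝒳 (-ᴱ x)
    Ideal-neg I = resp (λ _ → -1*x≈-x _) (Ideal-scale (- 1#) I)

    Ideal-neg⁻¹ : ∀ {x : Ext n} → Ideal 𝒳 (-ᴱ x) → Ideal 𝒳 x
    Ideal-neg⁻¹ I = resp (λ _ → -‿involutive _) (Ideal-neg I)

    Ideal-cancelˡ : ∀ {x y : Ext n} → Ideal 𝒳 x → Ideal 𝒳 (x +ᴱ y) → Ideal 𝒳 y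
    Ideal-cancelˡ I J = resp (λ _ → \\-leftDividesʳ _ _) (add (Ideal-neg I) J)

    Ideal-cancelʳ : ∀ {x y : Ext n} → Ideal 𝒳 (x +ᴱ y) → Ideal 𝒳 y → Ideal 𝒳 x
    Ideal-cancelʳ I J = resp (λ _ → //-rightDividesʳ _ _) (add I (Ideal-neg J))

    Ideal-altSum : ∀ {k} {X : Subset k} F → (∀ j → j ∈ X → Ideal 𝒳 (F j)) → Ideal 𝒳 (altSumᴱ X F)
    Ideal-altSum {X = []}          F I = zer
    Ideal-altSum {X = outside ∷ X} F I = Ideal-altSum (F ∘ suc) (λ j → I (suc j) ∘ there)
    Ideal-altSum {X = inside  ∷ X} F I =
      add (I zero here) (Ideal-neg (Ideal-altSum (F ∘ suc) (λ j → I (suc j) ∘ there)))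

    Ideal-altSum-term : ∀ {k} {X : Subset k} {i} F → i ∈ X → (∀ j → j ∈ X → j ≢ i → Ideal 𝒳 (F j)) →
                        Ideal 𝒳 (altSumᴱ X F) → Ideal 𝒳 (F i)
    Ideal-altSum-term {X = inside ∷ X} F here I Σ =
      Ideal-cancelʳ Σ (Ideal-neg (Ideal-altSum (F ∘ suc) (λ j j∈X → I (suc j) (there j∈X) λ ())))
    Ideal-altSum-term {X = outside ∷ X} F (there i∈X) I Σ =
      Ideal-altSum-term (F ∘ suc) i∈X (λ j j∈X j≢i → I (suc j) (there j∈X) (j≢i ∘ suc-injective)) Σ
    Ideal-altSum-term {X = inside ∷ X} F (there i∈X) I Σ =
      Ideal-altSum-term (F ∘ suc) i∈X (λ j j∈X j≢i → I (suc j) (there j∈X) (j≢i ∘ suc-injective))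
        (Ideal-neg⁻¹ (Ideal-cancelˡ (I zero here λ ()) Σ))

    Ideal-e : ∀ {X : Subset n} {k} → k ∈ X → Ideal 𝒳 (∂e X) → Ideal 𝒳 (e X)
    Ideal-e k∈X I = resp (λ Y → sym (e≋e⁅k⁆∧∂e k∈X Y)) (mulˡ _ I)

    -- Leibniz rule: ∂(e_k ∧ e_X) = e_X − e_k ∧ ∂(e_X)
    Ideal-∂e-cover : ∀ {X Y : Subset n} → Nonempty X → X ⋖ Y → Ideal 𝒳 (∂e X) → Ideal 𝒳 (∂e Y)
    Ideal-∂e-cover {X} (_ , x∈X) (cover {k = k} k∉X) I =
      resp (λ Y → sym (∂e-insert k∉X Y))
           (add (Ideal-scale σ (Ideal-e x∈X I))
                (resp (∧-·e⁅⁆ k (λ _ → refl) (∂e X)) (mulˡ ((- σ) ·e⁅ k ⁆) I)))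
      where
      σ : Carrier
      σ = sign k X

    Ideal-∂e-mono : ∀ {X Y : Subset n} → Nonempty X → X ⊆ Y → Ideal 𝒳 (∂e X) → Ideal 𝒳 (∂e Y)
    Ideal-∂e-mono X≢∅ X⊆Y = along X≢∅ (⊆⇒⋖* X⊆Y)
      where
      along : ∀ {X Y} → Nonempty X → Star _⋖_ X Y → Ideal 𝒳 (∂e X) → Ideal 𝒳 (∂e Y)
      along _             ε             I = I
      along (x , x∈X) (X⋖Z ◅ Z⋖*Y) I =
        along (x , ⋖⇒⊆ X⋖Z x∈X) Z⋖*Y (Ideal-∂e-cover (x , x∈X) X⋖Z I)

    -- ∂∂ = 0 expresses ∂(e_{X - i}) through the ∂(e_{X - j}), j ≠ i
    Ideal-∂e-minus : ∀ {X : Subset n} {i} → i ∈ X →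
                     (∀ j → j ∈ X → j ≢ i → Ideal 𝒳 (∂e (X - j))) → Ideal 𝒳 (∂e (X - i))
    Ideal-∂e-minus {X} {i} i∈X I =
      ≡.subst (Ideal 𝒳 ∘ ∂e) (≡.sym (p-x≡p[x]≔outside X i))
        (Ideal-altSum-term (λ j → ∂e (X [ j ]≔ outside)) i∈X
          (λ j j∈X j≢i → ≡.subst (Ideal 𝒳 ∘ ∂e) (p-x≡p[x]≔outside X j) (I j j∈X j≢i))
          (resp (λ Y → sym (altSum-∂e≈0# X Y)) zer))

    clΔ'⊆∂e-Ideal : (∀ X → 𝒳 X → Nonempty X) → ∀ {X} → clΔ' 𝒳 X → Ideal 𝒳 (∂e X)
    clΔ'⊆∂e-Ideal 𝒳-nonempty (base 𝒳X) = gen 𝒳X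
    clΔ'⊆∂e-Ideal 𝒳-nonempty (up d X₀⊆X) =
      Ideal-∂e-mono (clΔ'-nonempty 𝒳-nonempty d) X₀⊆X (clΔ'⊆∂e-Ideal 𝒳-nonempty d)
    clΔ'⊆∂e-Ideal 𝒳-nonempty (s3 X i _ i∈X d) =
      Ideal-∂e-minus i∈X (λ j j∈X j≢i → clΔ'⊆∂e-Ideal 𝒳-nonempty (d j j∈X j≢i))

    Ideal≐Ideal-clΔ' : (∀ X → 𝒳 X → Nonempty X) → Ideal 𝒳 ≐ Ideal (clΔ' 𝒳)
    Ideal≐Ideal-clΔ' 𝒳-nonempty = Ideal-mono (λ _ → base) , Ideal-⊆ (clΔ'⊆∂e-Ideal 𝒳-nonempty)

proposition9 : ∀ {c ℓ} (K : Field c ℓ) (n : ℕ) (M : Matroid n) → Simple M →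
    let open Exterior (Field.commutativeRing K) in
    (∀ (C' : Family n Level.zero) → C' ⊆F Matroid.Circuit M →
       (clΔ C' ⊆F clΔ' C') × (Ideal C' ≐ Ideal (clΔ' C')))
    × (Matroid.Circuit M ⊆F clΔ' (Circuits≤3 M) →
       Ideal (Matroid.Circuit M) ≐ Ideal (Circuits≤3 M))
proposition9 K n M simple = sub-families , quadratic
  where
  open Exterior (Field.commutativeRing K)
  open ExteriorCalculus (Field.commutativeRing K)
  open Matroid M using (Circuit)

  circuit-nonempty : ∀ X → Circuit X → Nonempty X
  circuit-nonempty X C = 0<∣p∣⇒Nonempty (≤-trans (s≤s z≤n) (simple X C))

  sub-families : ∀ C' → C' ⊆F Circuit → (clΔ C' ⊆F clΔ' C') × (Ideal C' ≐ Ideal (clΔ' C'))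
  sub-families C' C'⊆C = clΔ⊆clΔ' , Ideal≐Ideal-clΔ' (λ X → circuit-nonempty X ∘ C'⊆C X)

  quadratic : Circuit ⊆F clΔ' (Circuits≤3 M) → Ideal Circuit ≐ Ideal (Circuits≤3 M)
  quadratic C⊆clC₃ =
    (λ x → proj₂ (proj₂ (sub-families (Circuits≤3 M) (λ _ → proj₁))) x ∘ Ideal-mono C⊆clC₃ x)
    , Ideal-mono (λ _ → proj₁)
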